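{- Let $p$ be a partially ordered pattern. Let $a(n)$ be the number of permutations of $[n]$ avoiding $p$ and $a^{\star}(n)$ the number of permutations of $[n]$ quasi-avoiding $p$, and let $A(x)=\sum_{n\ge0}a(n)\frac{x^n}{n!}$ and $A^{\star}(x)=\sum_{n\ge0}a^{\star}(n)\frac{x^n}{n!}$. Then $$A^{\star}(x)=(x-1)A(x)+1.$$
   Context: A partially ordered pattern (POP) of length $k$ is a poset on the set $[k]$; an occurrence of it in a permutation $\pi=\pi_1\cdots\pi_n$ is a subsequence $\pi_{i_1}\cdots\pi_{i_k}$ with $i_1<\cdots<i_k$ such that $\pi_{i_j}<\pi_{i_m}$ whenever $j<m$ in the poset. A permutation avoids $p$ if it has no occurrence of $p$. For a sequence $s$ of distinct numbers, $\mathrm{red}(s)$ replaces the $i$-th smallest entry by $i$. A permutation $\pi=\pi_1\cdots\pi_n$ quasi-avoids $p$ if $\pi$ contains at least one occurrence of $p$ but $\mathrm{red}(\pi_1\cdots\pi_{n-1})$ contains no occurrence of $p$. The empty permutation avoids $p$ (when $p$ is nonempty). -}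

module Defs where

open import Level using (0ℓ)
open import Data.Nat using (ℕ; zero; suc; _<_; _<?_; _*_)
open import Data.Integer as ℤ using (ℤ; +_; _-_)
open import Data.Fin as Fin using (Fin; toℕ)
open import Data.Vec using (Vec; lookup; map; toList; init)
open import Data.List as List using (List; length; filter)
open import Data.List.Membership.Propositional using (_∈_)
open import Data.List.Relation.Unary.Unique.Propositional using (Unique)
open import Data.Product using (Σ; _×_)
open import Function.Definitions using (Injective)
open import Function.Bundles using (_⇔_)
open import Relation.Binary.Core using (Rel)
open import Relation.Binary.PropositionalEquality using (_≡_)
open import Relation.Nullary using (¬_)
open import Data.Empty using (⊥)

-- A partially ordered pattern of length k: a strict partial order _≺_ on [k] = Fin k
-- ("j < m in the poset" is  j ≺ m).

Occurs : {k : ℕ} → Rel (Fin k) 0ℓ → {m : ℕ} → Vec ℕ m → Set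
Occurs {k} _≺_ {m} s =
  Σ (Fin k → Fin m) λ ι →
    ((j l : Fin k) → j Fin.< l → ι j Fin.< ι l) ×
    ((j l : Fin k) → j ≺ l → lookup s (ι j) < lookup s (ι l))

Contains : {k : ℕ} → Rel (Fin k) 0ℓ → {m : ℕ} → Vec ℕ m → Set
Contains = Occurs

Avoids : {k : ℕ} → Rel (Fin k) 0ℓ → {m : ℕ} → Vec ℕ m → Set
Avoids _≺_ s = ¬ Contains _≺_ s

-- red(s): replace the i-th smallest entry by i (for sequences of distinct numbers):
-- entry x becomes 1 + #{entries y of s with y < x}.
red : {m : ℕ} → Vec ℕ m → Vec ℕ m
red s = map (λ x → suc (length (filter (_<? x) (toList s)))) s

-- Permutations of [n]: words π = π₁⋯πₙ with entries in [n] (here encoded by Fin n,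
-- i.e. values 0..n-1 standing for 1..n), all distinct.
IsPerm : {n : ℕ} → Vec (Fin n) n → Set
IsPerm π = Injective _≡_ _≡_ (lookup π)

asNat : {n : ℕ} → Vec (Fin n) n → Vec ℕ n
asNat π = map (λ i → suc (toℕ i)) π

-- π quasi-avoids p: π contains p but red(π₁⋯π_{n-1}) avoids p.
-- (For the empty permutation, which has no last entry, this is false;
--  it is consistent anyway since the empty permutation avoids a nonempty p.)
QuasiAvoids : {k : ℕ} → Rel (Fin k) 0ℓ → {n : ℕ} → Vec (Fin n) n → Set
QuasiAvoids _≺_ {zero} π = ⊥
QuasiAvoids _≺_ {suc n} π =
  Contains _≺_ (asNat π) × Avoids _≺_ (red (init (asNat π)))

NumberOfPermsWith : (n : ℕ) → (Vec (Fin n) n → Set) → ℕ → Set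
NumberOfPermsWith n P c =
  Σ (List (Vec (Fin n) n)) λ xs →
    Unique xs × (length xs ≡ c) ×
    ((π : Vec (Fin n) n) → (π ∈ xs) ⇔ (IsPerm π × P π))

-- Coefficient of x^n/n! in (x - 1) A(x) + 1, where A(x) = Σ a(n) x^n/n!.
-- Since x · Σ a(n) x^n/n! = Σ_{n≥1} n·a(n-1) x^n/n!, this coefficient is
--   1 - a(0)                 for n = 0,
--   (n+1)·a(n) - a(n+1)      for n+1.
egfCoeff-xMinus1-times-A-plus-1 : (ℕ → ℕ) → ℕ → ℤ
egfCoeff-xMinus1-times-A-plus-1 a zero = + 1 - + a 0
egfCoeff-xMinus1-times-A-plus-1 a (suc n) = + (suc n * a n) - + a (suc n)

{-# OPTIONS --safe #-}
module Submission where

-- Write a permutation π of [n+1] as its prefix followed by its last value v.  Removing v and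
-- closing the gap (punchOut) turns the prefix into a permutation σ of [n] with the same relative
-- order, and (v , σ) ↦ π is a bijection; so exactly (n+1)·a(n) permutations of [n+1] have a
-- p-avoiding prefix.  Since red also preserves relative order, these are precisely the
-- permutations that avoid p together with those that quasi-avoid p, whence
-- a(n+1) + a*(n+1) = (n+1)·a(n).  For n = 0, the empty permutation avoids p and none
-- quasi-avoids it.

open import Defs
open import Level using (0ℓ)
open import Data.Nat using (ℕ; zero; suc; _<_; _≤_; z≤n; s≤s; _<?_; _+_; _*_; _∸_)
open import Data.Nat.Properties
  using (<-irrefl; <-≤-trans; m≤m+n; <-trans; <⇒≤; m≤n⇒m≤1+n; ≰⇒>; <⇒≱; ≮⇒≥; m+n∸m≡n;
         ≤-pred)
open import Data.Integer using (+_; _⊖_) renaming (_-_ to _-ℤ_)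
open import Data.Integer.Properties using ([+m]-[+n]≡m⊖n; ⊖-≥) renaming (_≟_ to _≟ℤ_)
open import Data.Fin using (Fin; zero; suc; toℕ; fromℕ; fromℕ<; inject₁; punchIn; punchOut)
open import Data.Fin.Properties
  using (toℕ-inject₁; inject₁-injective; fromℕ≢inject₁; punchIn-injective; punchInᵢ≢i;
         punchIn-mono-≤; punchIn-cancel-≤; punchOut-injective; punchIn-punchOut)
open import Data.Fin.Relation.Unary.Top using (view; ‵fromℕ; ‵inject₁)
open import Data.Vec using (Vec; []; _∷_; lookup; map; toList; init; _∷ʳ_; tabulate; initLast)
open import Data.Vec.Properties
  using (lookup-map; map-∷ʳ; init-∷ʳ; map-∘; ∷ʳ-injective; ∷-injective;
         lookup∘tabulate; tabulate∘lookup; tabulate-cong; tabulate-∘)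
open import Data.List as List using (List; length; filter; allFin; cartesianProduct; _++_)
open import Data.List.Properties
  using (length-++; length-map; length-tabulate; filter-accept; filter-reject)
open import Data.List.Membership.Propositional using (_∈_)
open import Data.List.Membership.Propositional.Properties
  using (∈-map⁺; ∈-map⁻; ∈-cartesianProduct⁺; ∈-cartesianProduct⁻; ∈-allFin;
         ∈-++⁺ˡ; ∈-++⁺ʳ; ∈-++⁻)
open import Data.List.Membership.Propositional.Properties.WithK using (unique∧set⇒bag)
open import Data.List.Relation.Binary.BagAndSetEquality using (∼bag⇒↭)
open import Data.List.Relation.Binary.Permutation.Propositional.Properties using (↭-length)
open import Data.List.Relation.Unary.Any using (here; there)
import Data.List.Relation.Unary.All as All
import Data.List.Relation.Unary.AllPairs as AllPairs
open import Data.List.Relation.Unary.Unique.Propositional using (Unique)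
import Data.List.Relation.Unary.Unique.Propositional.Properties as Unique
open import Data.Product using (Σ; _×_; _,_; proj₁; proj₂; uncurry)
open import Data.Sum using (inj₁; inj₂)
open import Data.Empty using (⊥-elim)
open import Function using (_∘_)
open import Function.Definitions using (Injective)
open import Function.Bundles using (_⇔_; Equivalence; mk⇔)
open import Relation.Binary.Core using (Rel)
open import Relation.Binary.Structures using (IsStrictPartialOrder)
open import Relation.Binary.PropositionalEquality
open import Relation.Nullary using (¬_; yes; no; Dec)
open import Relation.Nullary.Decidable using (decidable-stable; ¬¬-excluded-middle)
open import Relation.Nullary.Negation using (¬¬-Monad; ¬¬-map)

open Equivalence

length-cartesianProduct : {A B : Set} (xs : List A) (ys : List B) →
                          length (cartesianProduct xs ys) ≡ length xs * length ys
length-cartesianProduct List.[] ys = refl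
length-cartesianProduct (x List.∷ xs) ys = begin
  length (List.map (x ,_) ys ++ cartesianProduct xs ys)
    ≡⟨ length-++ (List.map (x ,_) ys) ⟩
  length (List.map (x ,_) ys) + length (cartesianProduct xs ys)
    ≡⟨ cong₂ _+_ (length-map (x ,_) ys) (length-cartesianProduct xs ys) ⟩
  length ys + length xs * length ys ∎
  where open ≡-Reasoning

sameMembers⇒length≡ : {A : Set} {xs ys : List A} → Unique xs → Unique ys →
                      (∀ z → (z ∈ xs) ⇔ (z ∈ ys)) → length xs ≡ length ys
sameMembers⇒length≡ uxs uys xs⇔ys =
  ↭-length (∼bag⇒↭ (unique∧set⇒bag uxs uys (λ {z} → xs⇔ys z)))

¬¬-decideMembers : {A : Set} {P : A → Set} (xs : List A) → ¬ ¬ (All.All (Dec ∘ P) xs)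
¬¬-decideMembers xs = All.sequenceM 0ℓ ¬¬-Monad (All.tabulate (λ _ → ¬¬-excluded-middle))

lookup-∷ʳ-inject₁ : {A : Set} {n : ℕ} (xs : Vec A n) (x : A) (i : Fin n) →
                    lookup (xs ∷ʳ x) (inject₁ i) ≡ lookup xs i
lookup-∷ʳ-inject₁ (y ∷ xs) x zero    = refl
lookup-∷ʳ-inject₁ (y ∷ xs) x (suc i) = lookup-∷ʳ-inject₁ xs x i

lookup-∷ʳ-fromℕ : {A : Set} {n : ℕ} (xs : Vec A n) (x : A) → lookup (xs ∷ʳ x) (fromℕ n) ≡ x
lookup-∷ʳ-fromℕ []       x = refl
lookup-∷ʳ-fromℕ (y ∷ xs) x = lookup-∷ʳ-fromℕ xs x

module _ {A : Set} {n : ℕ} (ys : Vec A n) (y : A) where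

  lookup-∷ʳ-injective⁺ : Injective _≡_ _≡_ (lookup ys) → (∀ i → y ≢ lookup ys i) →
                         Injective _≡_ _≡_ (lookup (ys ∷ʳ y))
  lookup-∷ʳ-injective⁺ inj fresh {i} {j} eq with view i | view j
  ... | ‵fromℕ     | ‵fromℕ     = refl
  ... | ‵fromℕ     | ‵inject₁ b = ⊥-elim (fresh b (trans (sym (lookup-∷ʳ-fromℕ ys y))
                                     (trans eq (lookup-∷ʳ-inject₁ ys y b))))
  ... | ‵inject₁ a | ‵fromℕ     = ⊥-elim (fresh a (trans (sym (lookup-∷ʳ-fromℕ ys y))
                                     (trans (sym eq) (lookup-∷ʳ-inject₁ ys y a))))
  ... | ‵inject₁ a | ‵inject₁ b = cong inject₁ (inj (trans (sym (lookup-∷ʳ-inject₁ ys y a))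
                                     (trans eq (lookup-∷ʳ-inject₁ ys y b))))

  lookup-∷ʳ-injective⁻ : Injective _≡_ _≡_ (lookup (ys ∷ʳ y)) →
                         Injective _≡_ _≡_ (lookup ys) × (∀ i → y ≢ lookup ys i)
  lookup-∷ʳ-injective⁻ inj = inj-ys , fresh
    where
    inj-ys : Injective _≡_ _≡_ (lookup ys)
    inj-ys {i} {j} eq = inject₁-injective
      (inj (trans (lookup-∷ʳ-inject₁ ys y i) (trans eq (sym (lookup-∷ʳ-inject₁ ys y j)))))
    fresh : ∀ i → y ≢ lookup ys i
    fresh i eq = fromℕ≢inject₁
      (inj (trans (lookup-∷ʳ-fromℕ ys y) (trans eq (sym (lookup-∷ʳ-inject₁ ys y i)))))

extend : {n : ℕ} → Fin (suc n) → Vec (Fin n) n → Vec (Fin (suc n)) (suc n)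
extend v σ = map (punchIn v) σ ∷ʳ v

extend-injective : {n : ℕ} {v w : Fin (suc n)} {σ τ : Vec (Fin n) n} →
                   extend v σ ≡ extend w τ → (v , σ) ≡ (w , τ)
extend-injective {v = v} {σ = σ} {τ} eq with ∷ʳ-injective (map (punchIn v) σ) _ eq
... | mapσ≡mapτ , refl = cong (v ,_) (map-injective σ τ mapσ≡mapτ)
  where
  map-injective : ∀ {m} (σ τ : Vec _ m) → map (punchIn v) σ ≡ map (punchIn v) τ → σ ≡ τ
  map-injective []      []      _  = refl
  map-injective (x ∷ σ) (y ∷ τ) eq with ∷-injective eq
  ... | x′≡y′ , σ′≡τ′ = cong₂ _∷_ (punchIn-injective v x y x′≡y′) (map-injective σ τ σ′≡τ′)

IsPerm-extend : {n : ℕ} (v : Fin (suc n)) (σ : Vec (Fin n) n) →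
                IsPerm σ → IsPerm (extend v σ)
IsPerm-extend v σ σ-perm = lookup-∷ʳ-injective⁺ (map (punchIn v) σ) v injective fresh
  where
  injective : Injective _≡_ _≡_ (lookup (map (punchIn v) σ))
  injective {i} {j} eq = σ-perm (punchIn-injective v _ _
    (trans (sym (lookup-map i (punchIn v) σ)) (trans eq (lookup-map j (punchIn v) σ))))
  fresh : ∀ i → v ≢ lookup (map (punchIn v) σ) i
  fresh i eq = punchInᵢ≢i v (lookup σ i) (sym (trans eq (lookup-map i (punchIn v) σ)))

IsPerm⇒extend : {n : ℕ} (ys : Vec (Fin (suc n)) n) (y : Fin (suc n)) → IsPerm (ys ∷ʳ y) →
                Σ (Vec (Fin n) n) λ σ → IsPerm σ × ys ∷ʳ y ≡ extend y σ
IsPerm⇒extend {n} ys y perm = σ , σ-perm , cong (_∷ʳ y) ys≡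
  where
  open ≡-Reasoning
  ys-perm : Injective _≡_ _≡_ (lookup ys)
  ys-perm = proj₁ (lookup-∷ʳ-injective⁻ ys y perm)
  fresh : ∀ i → y ≢ lookup ys i
  fresh = proj₂ (lookup-∷ʳ-injective⁻ ys y perm)
  entry : Fin n → Fin n
  entry i = punchOut (fresh i)
  σ : Vec (Fin n) n
  σ = tabulate entry
  σ-perm : IsPerm σ
  σ-perm {i} {j} eq = ys-perm (punchOut-injective (fresh i) (fresh j)
    (trans (sym (lookup∘tabulate entry i)) (trans eq (lookup∘tabulate entry j))))
  ys≡ : ys ≡ map (punchIn y) σ
  ys≡ = begin
    ys                           ≡⟨ tabulate∘lookup ys ⟨
    tabulate (lookup ys)         ≡⟨ tabulate-cong (λ i → punchIn-punchOut (fresh i)) ⟨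
    tabulate (punchIn y ∘ entry) ≡⟨ tabulate-∘ (punchIn y) entry ⟩
    map (punchIn y) σ            ∎

countBelow : ℕ → List ℕ → ℕ
countBelow x xs = length (filter (_<? x) xs)

countBelow-∷-< : {x z : ℕ} (xs : List ℕ) → z < x →
                 countBelow x (z List.∷ xs) ≡ suc (countBelow x xs)
countBelow-∷-< {x} xs z<x = cong length (filter-accept (_<? x) {xs = xs} z<x)

countBelow-∷-≮ : {x z : ℕ} (xs : List ℕ) → ¬ z < x → countBelow x (z List.∷ xs) ≡ countBelow x xs
countBelow-∷-≮ {x} xs z≮x = cong length (filter-reject (_<? x) {xs = xs} z≮x)

countBelow-mono : {x y : ℕ} → x ≤ y → (xs : List ℕ) → countBelow x xs ≤ countBelow y xs
countBelow-mono x≤y List.[] = z≤n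
countBelow-mono {x} {y} x≤y (z List.∷ xs) with z <? x | z <? y
... | yes z<x | yes z<y rewrite countBelow-∷-< xs z<x | countBelow-∷-< xs z<y =
  s≤s (countBelow-mono x≤y xs)
... | yes z<x | no z≮y  = ⊥-elim (z≮y (<-≤-trans z<x x≤y))
... | no z≮x  | yes z<y rewrite countBelow-∷-≮ xs z≮x | countBelow-∷-< xs z<y =
  m≤n⇒m≤1+n (countBelow-mono x≤y xs)
... | no z≮x  | no z≮y  rewrite countBelow-∷-≮ xs z≮x | countBelow-∷-≮ xs z≮y =
  countBelow-mono x≤y xs

countBelow-mono-< : {x y : ℕ} {xs : List ℕ} → x < y → x ∈ xs → countBelow x xs < countBelow y xs
countBelow-mono-< {x} {y} {.x List.∷ xs} x<y (here refl)
  rewrite countBelow-∷-≮ xs (<-irrefl {x} refl) | countBelow-∷-< xs x<y =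
  s≤s (countBelow-mono (<⇒≤ x<y) xs)
countBelow-mono-< {x} {y} {z List.∷ xs} x<y (there x∈xs) with z <? x | z <? y
... | yes z<x | yes z<y rewrite countBelow-∷-< xs z<x | countBelow-∷-< xs z<y =
  s≤s (countBelow-mono-< x<y x∈xs)
... | yes z<x | no z≮y  = ⊥-elim (z≮y (<-trans z<x x<y))
... | no z≮x  | yes z<y rewrite countBelow-∷-≮ xs z≮x | countBelow-∷-< xs z<y =
  m≤n⇒m≤1+n (countBelow-mono-< x<y x∈xs)
... | no z≮x  | no z≮y  rewrite countBelow-∷-≮ xs z≮x | countBelow-∷-≮ xs z≮y =
  countBelow-mono-< x<y x∈xs

Preserves< : {m : ℕ} → Vec ℕ m → Vec ℕ m → Set
Preserves< s t = ∀ i j → lookup s i < lookup s j → lookup t i < lookup t j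

map-preserves< : {A : Set} {m : ℕ} {f g : A → ℕ} → (∀ a b → f a < f b → g a < g b) →
                 (xs : Vec A m) → Preserves< (map f xs) (map g xs)
map-preserves< {f = f} {g} f<⇒g< xs i j fxᵢ<fxⱼ =
  subst₂ _<_ (sym (lookup-map i g xs)) (sym (lookup-map j g xs))
    (f<⇒g< _ _ (subst₂ _<_ (lookup-map i f xs) (lookup-map j f xs) fxᵢ<fxⱼ))

lookup∈toList : {m : ℕ} (s : Vec ℕ m) (i : Fin m) → lookup s i ∈ toList s
lookup∈toList (x ∷ s) zero    = here refl
lookup∈toList (x ∷ s) (suc i) = there (lookup∈toList s i)

lookup-red : {m : ℕ} (s : Vec ℕ m) (i : Fin m) →
             lookup (red s) i ≡ suc (countBelow (lookup s i) (toList s))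
lookup-red s i = lookup-map i _ s

red-preserves< : {m : ℕ} (s : Vec ℕ m) → Preserves< s (red s)
red-preserves< s i j sᵢ<sⱼ rewrite lookup-red s i | lookup-red s j =
  s≤s (countBelow-mono-< sᵢ<sⱼ (lookup∈toList s i))

red-reflects< : {m : ℕ} (s : Vec ℕ m) → Preserves< (red s) s
red-reflects< s i j rᵢ<rⱼ with lookup s i <? lookup s j
... | yes sᵢ<sⱼ = sᵢ<sⱼ
... | no sᵢ≮sⱼ  = ⊥-elim (<⇒≱ rᵢ<rⱼ (subst₂ _≤_ (sym (lookup-red s j)) (sym (lookup-red s i))
                    (s≤s (countBelow-mono (≮⇒≥ sᵢ≮sⱼ) (toList s)))))

punchIn-mono-< : {n : ℕ} (v : Fin (suc n)) (a b : Fin n) →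
                 toℕ a < toℕ b → toℕ (punchIn v a) < toℕ (punchIn v b)
punchIn-mono-< v a b a<b = ≰⇒> (λ b′≤a′ → <⇒≱ a<b (punchIn-cancel-≤ v b a b′≤a′))

punchIn-cancel-< : {n : ℕ} (v : Fin (suc n)) (a b : Fin n) →
                   toℕ (punchIn v a) < toℕ (punchIn v b) → toℕ a < toℕ b
punchIn-cancel-< v a b a′<b′ = ≰⇒> (λ b≤a → <⇒≱ a′<b′ (punchIn-mono-≤ v b a b≤a))

init-asNat-extend : {n : ℕ} (v : Fin (suc n)) (σ : Vec (Fin n) n) →
                    init (asNat (extend v σ)) ≡ map (suc ∘ toℕ ∘ punchIn v) σ
init-asNat-extend v σ = begin
  init (map (suc ∘ toℕ) (map (punchIn v) σ ∷ʳ v))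
    ≡⟨ cong init (map-∷ʳ (suc ∘ toℕ) v (map (punchIn v) σ)) ⟩
  init (map (suc ∘ toℕ) (map (punchIn v) σ) ∷ʳ suc (toℕ v))
    ≡⟨ init-∷ʳ (suc (toℕ v)) (map (suc ∘ toℕ) (map (punchIn v) σ)) ⟩
  map (suc ∘ toℕ) (map (punchIn v) σ)
    ≡⟨ map-∘ (suc ∘ toℕ) (punchIn v) σ ⟨
  map (suc ∘ toℕ ∘ punchIn v) σ ∎
  where open ≡-Reasoning

module _ {k : ℕ} (_≺_ : Rel (Fin k) 0ℓ) where

  Occurs-transfer : {m : ℕ} (s t : Vec ℕ m) → Preserves< s t → Occurs _≺_ s → Occurs _≺_ t
  Occurs-transfer s t s⇒t (ι , ι-mono , ι-pattern) =
    ι , ι-mono , λ j l j≺l → s⇒t (ι j) (ι l) (ι-pattern j l j≺l)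

  Occurs-∷ʳ : {m : ℕ} (ys : Vec ℕ m) (y : ℕ) → Occurs _≺_ ys → Occurs _≺_ (ys ∷ʳ y)
  Occurs-∷ʳ ys y (ι , ι-mono , ι-pattern) =
    inject₁ ∘ ι ,
    (λ j l j<l → subst₂ _<_ (sym (toℕ-inject₁ (ι j))) (sym (toℕ-inject₁ (ι l))) (ι-mono j l j<l)) ,
    (λ j l j≺l → subst₂ _<_ (sym (lookup-∷ʳ-inject₁ ys y (ι j)))
                              (sym (lookup-∷ʳ-inject₁ ys y (ι l)))
                              (ι-pattern j l j≺l))

  -- init s is proj₁ (initLast s), so matching on initLast s retypes occ as an occurrence in ys.
  Occurs-init : {m : ℕ} (s : Vec ℕ (suc m)) → Occurs _≺_ (init s) → Occurs _≺_ s
  Occurs-init s occ with initLast s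
  ... | ys , y , refl = Occurs-∷ʳ ys y occ

  PrefixAvoids : {n : ℕ} → Vec (Fin (suc n)) (suc n) → Set
  PrefixAvoids π = Avoids _≺_ (init (asNat π))

  PrefixAvoids-extend : {n : ℕ} (v : Fin (suc n)) (σ : Vec (Fin n) n) →
                        PrefixAvoids (extend v σ) ⇔ Avoids _≺_ (asNat σ)
  PrefixAvoids-extend {n} v σ rewrite init-asNat-extend v σ = mk⇔
    (λ avoids occ → avoids (Occurs-transfer (asNat σ) prefix punchIn-preserves< occ))
    (λ avoids occ → avoids (Occurs-transfer prefix (asNat σ) punchIn-reflects< occ))
    where
    prefix : Vec ℕ n
    prefix = map (suc ∘ toℕ ∘ punchIn v) σ
    punchIn-preserves< : Preserves< (asNat σ) prefix
    punchIn-preserves< = map-preserves< (λ a b → s≤s ∘ punchIn-mono-< v a b ∘ ≤-pred) σ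
    punchIn-reflects< : Preserves< prefix (asNat σ)
    punchIn-reflects< = map-preserves< (λ a b → s≤s ∘ punchIn-cancel-< v a b ∘ ≤-pred) σ

  prefixAvoiders : (n c : ℕ) → NumberOfPermsWith n (Avoids _≺_ ∘ asNat) c →
                   NumberOfPermsWith (suc n) PrefixAvoids (suc n * c)
  prefixAvoiders n c (As , As-unique , |As|≡c , As-spec) = Es , Es-unique , |Es|≡ , Es-spec
    where
    Es : List (Vec (Fin (suc n)) (suc n))
    Es = List.map (uncurry extend) (cartesianProduct (allFin (suc n)) As)

    Es-unique : Unique Es
    Es-unique = Unique.map⁺ extend-injective
                  (Unique.cartesianProduct⁺ (Unique.allFin⁺ (suc n)) As-unique)

    |Es|≡ : length Es ≡ suc n * c
    |Es|≡ = begin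
      length Es
        ≡⟨ length-map (uncurry extend) (cartesianProduct (allFin (suc n)) As) ⟩
      length (cartesianProduct (allFin (suc n)) As)
        ≡⟨ length-cartesianProduct (allFin (suc n)) As ⟩
      length (allFin (suc n)) * length As
        ≡⟨ cong₂ _*_ (length-tabulate {n = suc n} (λ i → i)) |As|≡c ⟩
      suc n * c ∎
      where open ≡-Reasoning

    sound : ∀ π → π ∈ Es → IsPerm π × PrefixAvoids π
    sound π π∈Es with ∈-map⁻ (uncurry extend) π∈Es
    ... | (v , σ) , vσ∈ , refl
          with to (As-spec σ) (proj₂ (∈-cartesianProduct⁻ (allFin (suc n)) As vσ∈))
    ... | σ-perm , σ-avoids = IsPerm-extend v σ σ-perm , from (PrefixAvoids-extend v σ) σ-avoids

    complete : ∀ π → IsPerm π × PrefixAvoids π → π ∈ Es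
    complete π (perm , prefixAvoids) with initLast π
    ... | ys , y , refl with IsPerm⇒extend ys y perm
    ... | σ , σ-perm , π≡ = subst (_∈ Es) (sym π≡)
      (∈-map⁺ (uncurry extend)
        (∈-cartesianProduct⁺ (∈-allFin y) (from (As-spec σ) (σ-perm , σ-avoids))))
      where
      σ-avoids : Avoids _≺_ (asNat σ)
      σ-avoids = to (PrefixAvoids-extend y σ) (subst PrefixAvoids π≡ prefixAvoids)

    Es-spec : ∀ π → (π ∈ Es) ⇔ (IsPerm π × PrefixAvoids π)
    Es-spec π = mk⇔ (sound π) (complete π)

  Avoids⇒PrefixAvoids : {n : ℕ} (π : Vec (Fin (suc n)) (suc n)) →
                        Avoids _≺_ (asNat π) → PrefixAvoids π
  Avoids⇒PrefixAvoids π avoids occ = avoids (Occurs-init (asNat π) occ)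

  QuasiAvoids⇒PrefixAvoids : {n : ℕ} (π : Vec (Fin (suc n)) (suc n)) →
                             QuasiAvoids _≺_ π → PrefixAvoids π
  QuasiAvoids⇒PrefixAvoids {n} π (_ , redAvoids) occ =
    redAvoids (Occurs-transfer prefix (red prefix) (red-preserves< prefix) occ)
    where
    prefix : Vec ℕ n
    prefix = init (asNat π)

  PrefixAvoids⇒QuasiAvoids : {n : ℕ} (π : Vec (Fin (suc n)) (suc n)) → PrefixAvoids π →
                             Contains _≺_ (asNat π) → QuasiAvoids _≺_ π
  PrefixAvoids⇒QuasiAvoids {n} π prefixAvoids occ =
    occ , λ redOcc →
      prefixAvoids (Occurs-transfer (red prefix) prefix (red-reflects< prefix) redOcc)
    where
    prefix : Vec ℕ n
    prefix = init (asNat π)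

  -- Sorting each permutation into "contains p" or not is excluded middle, hence the ¬ ¬.
  ¬¬-avoiders+quasiAvoiders : {n a a′ q : ℕ} → NumberOfPermsWith n (Avoids _≺_ ∘ asNat) a →
                              NumberOfPermsWith (suc n) (Avoids _≺_ ∘ asNat) a′ →
                              NumberOfPermsWith (suc n) (QuasiAvoids _≺_) q →
                              ¬ ¬ (a′ + q ≡ suc n * a)
  ¬¬-avoiders+quasiAvoiders {n} {a} count-a (As , As-unique , refl , As-spec)
                                             (Qs , Qs-unique , refl , Qs-spec)
    with prefixAvoiders n a count-a
  ... | Es , Es-unique , |Es|≡ , Es-spec = ¬¬-map length≡ (¬¬-decideMembers Es)
    where
    AQs-unique : Unique (As ++ Qs)
    AQs-unique = Unique.++⁺ As-unique Qs-unique λ {π} (π∈As , π∈Qs) →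
      proj₂ (to (As-spec π) π∈As) (proj₁ (proj₂ (to (Qs-spec π) π∈Qs)))

    AQs⊆Es : ∀ π → π ∈ As ++ Qs → π ∈ Es
    AQs⊆Es π π∈AQs with ∈-++⁻ As π∈AQs
    ... | inj₁ π∈As = let perm , avoids = to (As-spec π) π∈As in
                      from (Es-spec π) (perm , Avoids⇒PrefixAvoids π avoids)
    ... | inj₂ π∈Qs = let perm , quasi = to (Qs-spec π) π∈Qs in
                      from (Es-spec π) (perm , QuasiAvoids⇒PrefixAvoids π quasi)

    Es⊆AQs : All.All (Dec ∘ Contains _≺_ ∘ asNat) Es → ∀ π → π ∈ Es → π ∈ As ++ Qs
    Es⊆AQs decide π π∈Es with to (Es-spec π) π∈Es | All.lookup decide π∈Es
    ... | perm , prefixAvoids | no avoids = ∈-++⁺ˡ (from (As-spec π) (perm , avoids))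
    ... | perm , prefixAvoids | yes occ   =
      ∈-++⁺ʳ As (from (Qs-spec π) (perm , PrefixAvoids⇒QuasiAvoids π prefixAvoids occ))

    length≡ : All.All (Dec ∘ Contains _≺_ ∘ asNat) Es → length As + length Qs ≡ suc n * a
    length≡ decide = begin
      length As + length Qs ≡⟨ length-++ As ⟨
      length (As ++ Qs)     ≡⟨ sameMembers⇒length≡ AQs-unique Es-unique
                                 (λ π → mk⇔ (AQs⊆Es π) (Es⊆AQs decide π)) ⟩
      length Es             ≡⟨ |Es|≡ ⟩
      suc n * a             ∎
      where open ≡-Reasoning

  avoiders-0 : 0 < k → {c : ℕ} → NumberOfPermsWith 0 (Avoids _≺_ ∘ asNat) c → c ≡ 1
  avoiders-0 0<k (As , As-unique , refl , As-spec) =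
    sameMembers⇒length≡ As-unique (All.[] AllPairs.∷ AllPairs.[])
      λ { [] → mk⇔ (λ _ → here refl) (λ _ → from (As-spec []) (empty-perm , empty-avoids)) }
    where
    empty-perm : IsPerm {0} []
    empty-perm {()}
    empty-avoids : Avoids _≺_ []
    empty-avoids (ι , _) with ι (fromℕ< 0<k)
    ... | ()

  quasiAvoiders-0 : {c : ℕ} → NumberOfPermsWith 0 (QuasiAvoids _≺_) c → c ≡ 0
  quasiAvoiders-0 (List.[] , _ , refl , _) = refl
  quasiAvoiders-0 (π List.∷ _ , _ , refl , Qs-spec) =
    ⊥-elim (proj₂ (to (Qs-spec π) (here refl)))

m+n≡o⇒+n≡+o-+m : {m n o : ℕ} → m + n ≡ o → + n ≡ + o -ℤ + m
m+n≡o⇒+n≡+o-+m {m} {n} refl = begin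
  + n               ≡⟨ cong +_ (m+n∸m≡n m n) ⟨
  + (m + n ∸ m)     ≡⟨ ⊖-≥ (m≤m+n m n) ⟨
  (m + n) ⊖ m       ≡⟨ [+m]-[+n]≡m⊖n (m + n) m ⟨
  + (m + n) -ℤ + m  ∎
  where open ≡-Reasoning

proposition16 : (k : ℕ) → 0 < k → (_≺_ : Rel (Fin k) 0ℓ) → IsStrictPartialOrder _≡_ _≺_ →
    (a aStar : ℕ → ℕ) →
    ((n : ℕ) → NumberOfPermsWith n (λ π → Avoids _≺_ (asNat π)) (a n)) →
    ((n : ℕ) → NumberOfPermsWith n (QuasiAvoids _≺_) (aStar n)) →
    (n : ℕ) → + aStar n ≡ egfCoeff-xMinus1-times-A-plus-1 a n
proposition16 k 0<k _≺_ _ a aStar count-a count-q zero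
  rewrite quasiAvoiders-0 _≺_ (count-q 0) | avoiders-0 _≺_ 0<k (count-a 0) = refl
proposition16 k 0<k _≺_ _ a aStar count-a count-q (suc n) =
  decidable-stable (_ ≟ℤ _) (¬¬-map m+n≡o⇒+n≡+o-+m
    (¬¬-avoiders+quasiAvoiders _≺_ (count-a n) (count-a (suc n)) (count-q (suc n))))
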